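{- Let $\mathcal{C}$ be a clutter on a finite set $E$ satisfying the integral blocking condition such that $\mathrm{I}(\mathcal{C})$ is an integral polytope. Then the maximum fractional packing of $\mathcal{C}$ is unique if and only if $\mathrm{I}(\mathcal{C})$ is a simplex.
   Context: A clutter on $E$ is a family of subsets none containing another (members: hyperedges). A transversal is an inclusion-minimal subset meeting all hyperedges; $\mathrm{b}(\mathcal{C})$ the transversals, $\mathrm{bn}(\mathcal{C})$ the minimum transversal size, $\mathrm{minb}(\mathcal{C})$ the minimum-size transversals. A fractional packing is $y:\mathcal{C}\to\mathbb{R}_{\ge0}$ with $\sum_{H\ni a}y(H)\le1$ for all $a\in E$; a maximum fractional packing maximizes $\sum_Hy(H)$, with maximum value $\mathrm{fpn}(\mathcal{C})$. Integral blocking condition: $\mathrm{fpn}(\mathcal{C})=\mathrm{bn}(\mathcal{C})$. $\mathrm{I}(\mathcal{C})=\{x\in\mathbb{R}^E:\langle x,1_D\rangle=1\ \forall D\in\mathrm{minb}(\mathcal{C}),\ \langle x,1_D\rangle\ge1\ \forall D\in\mathrm{b}(\mathcal{C}),\ x\ge0\}$.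
   Formalization: Fractional packings take rational values, and $\mathrm{I}(\mathcal{C})$ together with the points spanning polytopes and simplices lies in ℚ^E instead of ℝ^E. -}

module Defs where

open import Data.Nat using (ℕ; zero; suc)
import Data.Nat as ℕ
open import Data.Integer using (ℤ; +_)
open import Data.Bool using (Bool; if_then_else_)
open import Data.Fin using (Fin; zero; suc)
open import Data.Fin.Subset using (Subset; _∈_; _⊆_; ∣_∣)
open import Data.Vec using (lookup)
open import Data.Rational using (ℚ; 0ℚ; 1ℚ; _+_; _*_; _≤_; _/_)
open import Data.Product using (Σ; ∃; ∃-syntax; _×_; _,_)
open import Relation.Binary.PropositionalEquality using (_≡_; _≢_)
open import Relation.Nullary using (¬_)
open import Function.Bundles using (_⇔_)

-- Ground set E = Fin n; a clutter with m hyperedges is C : Fin m → Subset n.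

sumFin : ∀ {k} → (Fin k → ℚ) → ℚ
sumFin {zero}  f = 0ℚ
sumFin {suc k} f = f zero + sumFin (λ i → f (suc i))

ℕtoℚ : ℕ → ℚ
ℕtoℚ k = (+ k) / 1

ind : Bool → ℚ → ℚ
ind b q = if b then q else 0ℚ

dot : ∀ {n} → (Fin n → ℚ) → Subset n → ℚ
dot x D = sumFin (λ a → ind (lookup D a) (x a))

IsClutter : ∀ {n m} → (Fin m → Subset n) → Set
IsClutter C = ∀ i j → i ≢ j → ¬ (C i ⊆ C j)

module _ {n m : ℕ} (C : Fin m → Subset n) where

  Meets : Subset n → Subset n → Set
  Meets D H = ∃[ a ] (a ∈ D × a ∈ H)

  IsCover : Subset n → Set
  IsCover D = ∀ i → Meets D (C i)

  IsTransversal : Subset n → Set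
  IsTransversal D = IsCover D × (∀ D′ → D′ ⊆ D → IsCover D′ → D′ ≡ D)

  IsMinTransversal : Subset n → Set
  IsMinTransversal D = IsTransversal D × (∀ D′ → IsTransversal D′ → ∣ D ∣ ℕ.≤ ∣ D′ ∣)

  IsPacking : (Fin m → ℚ) → Set
  IsPacking y = (∀ i → 0ℚ ≤ y i)
              × (∀ a → sumFin (λ i → ind (lookup (C i) a) (y i)) ≤ 1ℚ)

  IsMaxPacking : (Fin m → ℚ) → Set
  IsMaxPacking y = IsPacking y × (∀ y′ → IsPacking y′ → sumFin y′ ≤ sumFin y)

  -- integral blocking condition: fpn(C) = bn(C)
  IntegralBlocking : Set
  IntegralBlocking = ∃[ y ] ∃[ D ] (IsMaxPacking y × IsMinTransversal D × sumFin y ≡ ℕtoℚ ∣ D ∣)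

  UniqueMaxPacking : Set
  UniqueMaxPacking = ∀ y y′ → IsMaxPacking y → IsMaxPacking y′ → ∀ i → y i ≡ y′ i

  I : (Fin n → ℚ) → Set
  I x = (∀ D → IsMinTransversal D → dot x D ≡ 1ℚ)
      × (∀ D → IsTransversal D → 1ℚ ≤ dot x D)
      × (∀ a → 0ℚ ≤ x a)

InConv : ∀ {n k} → (Fin k → Fin n → ℚ) → (Fin n → ℚ) → Set
InConv {n} {k} p x = ∃[ λs ] ((∀ j → 0ℚ ≤ λs j) × sumFin λs ≡ 1ℚ
                               × (∀ a → x a ≡ sumFin (λ j → λs j * p j a)))

AffinelyIndependent : ∀ {n k} → (Fin k → Fin n → ℚ) → Set
AffinelyIndependent {n} {k} p =
  ∀ (μ : Fin k → ℚ) → sumFin μ ≡ 0ℚ → (∀ a → sumFin (λ j → μ j * p j a) ≡ 0ℚ) → ∀ j → μ j ≡ 0ℚ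

IsIntegralPolytope : ∀ {n} → ((Fin n → ℚ) → Set) → Set
IsIntegralPolytope {n} P =
  ∃[ k ] Σ (Fin k → Fin n → ℤ) λ p → ∀ x → P x ⇔ InConv (λ j a → (p j a) / 1) x

IsSimplex : ∀ {n} → ((Fin n → ℚ) → Set) → Set
IsSimplex {n} P =
  ∃[ k ] Σ (Fin k → Fin n → ℚ) λ p → AffinelyIndependent p × (∀ x → P x ⇔ InConv p x)

-- Let τ = bn(C). If τ = 0 there are no hyperedges and I(C) is empty, so both sides hold.
-- Otherwise the uniform point (1/τ)·1 lies in I(C). Since I(C) is bounded, every element lies
-- in some minimum transversal; hence I(C) ⊆ [0,1]^E, every maximum packing has load exactly 1
-- at every element, and a point of I(C) is determined by its values on minimum transversals.
-- It follows that every integral vertex of I(C) is the incidence vector of a hyperedge, and,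
-- by complementary slackness, that the incidence vector of a hyperedge in the support of a
-- maximum packing belongs to every finite point set whose convex hull is I(C).
-- If I(C) is a simplex, the difference of two maximum packings yields an affine dependence
-- among its vertices, so it vanishes. If the maximum packing y₀ is unique, every vertex of
-- I(C) is a hyperedge in the support of y₀ (perturb the uniform point away from the vertex and
-- read off a maximum packing using it), so I(C) is the hull of the support hyperedges of y₀;
-- an affine dependence among them would move y₀ to a different maximum packing.

module Submission where

open import Defs
open import Data.Nat using (ℕ; zero; suc)
open import Data.Fin using (Fin)
open import Data.Fin.Subset using (Subset)
open import Function.Bundles using (_⇔_; mk⇔; Equivalence)

import Data.Nat as ℕ
import Data.Nat.Properties as ℕ
import Data.Nat.Induction as ℕ
open import Induction.WellFounded using (Acc; acc)
open import Data.Integer using (ℤ)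
import Data.Integer as ℤ
import Data.Integer.Properties as ℤ
open import Data.Bool using (Bool; true; false)
import Data.Bool.Properties as Bool
open import Data.Fin using (zero; suc)
import Data.Fin.Properties as Fin
open import Data.Fin.Subset using (_∈_; _∉_; _⊆_; ∣_∣; ∁)
import Data.Fin.Subset.Properties as Subset
open import Data.Vec using (lookup; tabulate)
import Data.Vec as Vec
open import Data.Vec.Properties using ([]=⇒lookup; lookup⇒[]=; lookup∘tabulate)
import Data.Vec.Properties as Vec
open import Data.List using ([]; _∷_)
open import Data.Rational
  using (ℚ; mkℚ; 0ℚ; 1ℚ; _+_; _*_; _-_; -_; _≤_; _<_; _/_; 1/_; _⊓_; NonZero; Positive; positive; nonNegative)
open import Data.Rational.Properties
open import Data.Nat.Coprimality using (1-coprimeTo) renaming (sym to coprime-sym)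
open import Data.Product using (Σ; ∃; ∃-syntax; _×_; _,_; proj₁; proj₂)
open import Data.Sum using (_⊎_; inj₁; inj₂)
import Data.Sum
open import Data.Empty using (⊥; ⊥-elim)
open import Relation.Binary.PropositionalEquality
open import Relation.Nullary using (¬_; Dec; yes; no; does)
open import Relation.Nullary.Decidable using (decidable-stable; dec-true; dec-false; dec⇒maybe; _→-dec_)
open import Tactic.RingSolver using (solve; solve-∀)
open import Tactic.RingSolver.Core.AlmostCommutativeRing using (AlmostCommutativeRing; fromCommutativeRing)
open import Level using (0ℓ)
open import Algebra.Bundles using (CommutativeMonoid)
open import Algebra.Properties.Group +-0-group using () renaming (identityʳ-unique to +-identityʳ-unique)
open import Algebra.Properties.CommutativeSemigroup
  (CommutativeMonoid.commutativeSemigroup +-0-commutativeMonoid) using () renaming (interchange to +-interchange)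
open import Function using (_∘_)
open import Function.Definitions using (Injective)
open import Relation.Binary.Definitions using (tri<; tri≈; tri>)

-- Rational arithmetic

ℚ-ring : AlmostCommutativeRing 0ℓ 0ℓ
ℚ-ring = fromCommutativeRing +-*-commutativeRing (λ x → dec⇒maybe (0ℚ ≟ x))

open ≤-Reasoning

0≤1 : 0ℚ ≤ 1ℚ
0≤1 = nonNegative⁻¹ 1ℚ

0<1 : 0ℚ < 1ℚ
0<1 = positive⁻¹ 1ℚ

≤⇒0≤- : ∀ {x y} → x ≤ y → 0ℚ ≤ y - x
≤⇒0≤- {x} {y} x≤y = begin
  0ℚ     ≡⟨ sym (+-inverseʳ x) ⟩
  x - x  ≤⟨ +-monoˡ-≤ (- x) x≤y ⟩
  y - x  ∎

x-y≡0⇒x≡y : ∀ {x y} → x - y ≡ 0ℚ → x ≡ y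
x-y≡0⇒x≡y {x} {y} x-y≡0 = begin-equality
  x            ≡⟨ solve (x ∷ y ∷ []) ℚ-ring ⟩
  (x - y) + y  ≡⟨ cong (_+ y) x-y≡0 ⟩
  0ℚ + y       ≡⟨ +-identityˡ y ⟩
  y            ∎

x*[y-1]≡x*y-x : ∀ x y → x * (y - 1ℚ) ≡ x * y - x
x*[y-1]≡x*y-x = solve-∀ ℚ-ring

*-distribʳ-- : ∀ z x y → (x - y) * z ≡ x * z - y * z
*-distribʳ-- = solve-∀ ℚ-ring

*-congˡ-≢0 : ∀ x {u v} → (x ≢ 0ℚ → u ≡ v) → x * u ≡ x * v
*-congˡ-≢0 x {u} {v} u≡v with x ≟ 0ℚ
... | yes refl = trans (*-zeroˡ u) (sym (*-zeroˡ v))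
... | no  x≢0  = cong (x *_) (u≡v x≢0)

0≤* : ∀ {x y} → 0ℚ ≤ x → 0ℚ ≤ y → 0ℚ ≤ x * y
0≤* {x} {y} 0≤x 0≤y =
  nonNegative⁻¹ _ {{nonNeg*nonNeg⇒nonNeg x {{nonNegative 0≤x}} y {{nonNegative 0≤y}}}}

0<* : ∀ {x y} → 0ℚ < x → 0ℚ < y → 0ℚ < x * y
0<* {x} {y} 0<x 0<y = positive⁻¹ _ {{pos*pos⇒pos x {{positive 0<x}} y {{positive 0<y}}}}

0≤∧≢0⇒0< : ∀ {x} → 0ℚ ≤ x → x ≢ 0ℚ → 0ℚ < x
0≤∧≢0⇒0< {x} 0≤x x≢0 with <-cmp 0ℚ x
... | tri< 0<x _ _ = 0<x
... | tri≈ _ 0≡x _ = ⊥-elim (x≢0 (sym 0≡x))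
... | tri> _ _ x<0 = ⊥-elim (<-irrefl refl (≤-<-trans 0≤x x<0))

0<∧*≡0⇒≡0 : ∀ {c x} → 0ℚ < c → c * x ≡ 0ℚ → x ≡ 0ℚ
0<∧*≡0⇒≡0 {c} {x} 0<c cx≡0 = begin-equality
  x                ≡⟨ sym (*-identityˡ x) ⟩
  1ℚ * x           ≡⟨ cong (_* x) (sym (*-inverseˡ c)) ⟩
  (1/ c) * c * x   ≡⟨ *-assoc (1/ c) c x ⟩
  (1/ c) * (c * x) ≡⟨ cong ((1/ c) *_) cx≡0 ⟩
  (1/ c) * 0ℚ      ≡⟨ *-zeroʳ (1/ c) ⟩
  0ℚ               ∎
  where instance _ = pos⇒nonZero c {{positive 0<c}}

ℕtoℚ-suc : ∀ k → ℕtoℚ (suc k) ≡ 1ℚ + ℕtoℚ k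
ℕtoℚ-suc k = sym (begin-equality
  1ℚ + ℕtoℚ k                      ≡⟨ cong (1ℚ +_) (normalize-coprime k/1-coprime) ⟩
  1ℚ + mkℚ (ℤ.+ k) 0 k/1-coprime    ≡⟨ /-cong {q₁ = 1} (cong (ℤ._+_ ℤ.1ℤ) (ℤ.*-identityʳ (ℤ.+ k))) refl ⟩
  ℕtoℚ (suc k)                     ∎)
  where k/1-coprime = coprime-sym (1-coprimeTo k)

0≤ℕtoℚ : ∀ k → 0ℚ ≤ ℕtoℚ k
0≤ℕtoℚ k = nonNegative⁻¹ _ {{normalize-nonNeg k 1}}

0<ℕtoℚ : ∀ k → 0ℚ < ℕtoℚ (suc k)
0<ℕtoℚ k = positive⁻¹ _ {{normalize-pos (suc k) 1}}

ℕtoℚ-mono-≤ : ∀ {a b} → a ℕ.≤ b → ℕtoℚ a ≤ ℕtoℚ b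
ℕtoℚ-mono-≤ {b = b} ℕ.z≤n = 0≤ℕtoℚ b
ℕtoℚ-mono-≤ {suc a} {suc b} (ℕ.s≤s a≤b) = begin
  ℕtoℚ (suc a) ≡⟨ ℕtoℚ-suc a ⟩
  1ℚ + ℕtoℚ a  ≤⟨ +-monoʳ-≤ 1ℚ (ℕtoℚ-mono-≤ a≤b) ⟩
  1ℚ + ℕtoℚ b  ≡⟨ sym (ℕtoℚ-suc b) ⟩
  ℕtoℚ (suc b) ∎

1≤ℕtoℚ : ∀ k → 1ℚ ≤ ℕtoℚ (suc k)
1≤ℕtoℚ k = ℕtoℚ-mono-≤ {1} {suc k} (ℕ.s≤s ℕ.z≤n)

integer∈[0,1] : ∀ z → 0ℚ ≤ z / 1 → z / 1 ≤ 1ℚ → z / 1 ≡ 0ℚ ⊎ z / 1 ≡ 1ℚ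
integer∈[0,1] (ℤ.+ 0)           _   _   = inj₁ refl
integer∈[0,1] (ℤ.+ 1)           _   _   = inj₂ refl
integer∈[0,1] (ℤ.+ suc (suc k)) _   z≤1 = ⊥-elim (<-irrefl refl (<-≤-trans 1<z z≤1))
  where
  1<z : 1ℚ < ℕtoℚ (suc (suc k))
  1<z = begin-strict
    1ℚ                  ≡⟨ sym (+-identityʳ 1ℚ) ⟩
    1ℚ + 0ℚ             <⟨ +-monoʳ-< 1ℚ (0<ℕtoℚ k) ⟩
    1ℚ + ℕtoℚ (suc k)   ≡⟨ sym (ℕtoℚ-suc (suc k)) ⟩
    ℕtoℚ (suc (suc k))  ∎
integer∈[0,1] ℤ.-[1+ k ]        0≤z _   = ⊥-elim (<-irrefl refl (begin-strict
  0ℚ                              ≡⟨ sym (+-identityʳ 0ℚ) ⟩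
  0ℚ + 0ℚ                         <⟨ +-mono-<-≤ (0<ℕtoℚ k) 0≤z ⟩
  ℕtoℚ (suc k) - ℕtoℚ (suc k)     ≡⟨ +-inverseʳ (ℕtoℚ (suc k)) ⟩
  0ℚ                              ∎))

-- Finite sums

sum-cong : ∀ {k} {f g : Fin k → ℚ} → (∀ i → f i ≡ g i) → sumFin f ≡ sumFin g
sum-cong {zero}  f≗g = refl
sum-cong {suc k} f≗g = cong₂ _+_ (f≗g zero) (sum-cong (λ i → f≗g (suc i)))

sum-zero : ∀ k → sumFin {k} (λ _ → 0ℚ) ≡ 0ℚ
sum-zero zero    = refl
sum-zero (suc k) = trans (+-identityˡ _) (sum-zero k)

sum-distrib-+ : ∀ {k} (f g : Fin k → ℚ) → sumFin (λ i → f i + g i) ≡ sumFin f + sumFin g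
sum-distrib-+ {zero}  f g = refl
sum-distrib-+ {suc k} f g = begin-equality
  (f zero + g zero) + sumFin (λ i → f (suc i) + g (suc i))
    ≡⟨ cong (f zero + g zero +_) (sum-distrib-+ (λ i → f (suc i)) (λ i → g (suc i))) ⟩
  (f zero + g zero) + (F + G)
    ≡⟨ +-interchange (f zero) (g zero) F G ⟩
  (f zero + F) + (g zero + G) ∎
  where
  F = sumFin (λ i → f (suc i))
  G = sumFin (λ i → g (suc i))

*-distribˡ-sum : ∀ {k} c (f : Fin k → ℚ) → c * sumFin f ≡ sumFin (λ i → c * f i)
*-distribˡ-sum {zero}  c f = *-zeroʳ c
*-distribˡ-sum {suc k} c f =
  trans (*-distribˡ-+ c (f zero) _) (cong (c * f zero +_) (*-distribˡ-sum c (λ i → f (suc i))))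

*-distribʳ-sum : ∀ {k} c (f : Fin k → ℚ) → sumFin f * c ≡ sumFin (λ i → f i * c)
*-distribʳ-sum c f =
  trans (*-comm (sumFin f) c) (trans (*-distribˡ-sum c f) (sum-cong (λ i → *-comm c (f i))))

neg-distrib-sum : ∀ {k} (f : Fin k → ℚ) → - sumFin f ≡ sumFin (λ i → - f i)
neg-distrib-sum {zero}  f = refl
neg-distrib-sum {suc k} f =
  trans (neg-distrib-+ (f zero) _) (cong (- f zero +_) (neg-distrib-sum (λ i → f (suc i))))

sum-distrib-- : ∀ {k} (f g : Fin k → ℚ) → sumFin (λ i → f i - g i) ≡ sumFin f - sumFin g
sum-distrib-- f g =
  trans (sum-distrib-+ f (λ i → - g i)) (cong (sumFin f +_) (sym (neg-distrib-sum g)))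

sum-comm : ∀ {k l} (f : Fin k → Fin l → ℚ) →
           sumFin (λ i → sumFin (λ j → f i j)) ≡ sumFin (λ j → sumFin (λ i → f i j))
sum-comm {zero}  {l} f = sym (sum-zero l)
sum-comm {suc k} {l} f = begin-equality
  sumFin (f zero) + sumFin (λ i → sumFin (f (suc i)))
    ≡⟨ cong (sumFin (f zero) +_) (sum-comm (λ i → f (suc i))) ⟩
  sumFin (f zero) + sumFin (λ j → sumFin (λ i → f (suc i) j))
    ≡⟨ sum-distrib-+ (f zero) (λ j → sumFin (λ i → f (suc i) j)) ⟨
  sumFin (λ j → f zero j + sumFin (λ i → f (suc i) j)) ∎

sum-single : ∀ {k} (f : Fin k → ℚ) j → (∀ i → i ≢ j → f i ≡ 0ℚ) → sumFin f ≡ f j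
sum-single {suc k} f zero    f≡0 = begin-equality
  f zero + sumFin (λ i → f (suc i))  ≡⟨ cong (f zero +_) (trans (sum-cong (λ i → f≡0 (suc i) λ ())) (sum-zero k)) ⟩
  f zero + 0ℚ                        ≡⟨ +-identityʳ (f zero) ⟩
  f zero                             ∎
sum-single {suc k} f (suc j) f≡0 = begin-equality
  f zero + sumFin (λ i → f (suc i))  ≡⟨ cong₂ _+_ (f≡0 zero λ ())
                                          (sum-single (λ i → f (suc i)) j (λ i i≢j → f≡0 (suc i) (i≢j ∘ Fin.suc-injective))) ⟩
  0ℚ + f (suc j)                     ≡⟨ +-identityˡ (f (suc j)) ⟩
  f (suc j)                          ∎

sum-mono-≤ : ∀ {k} {f g : Fin k → ℚ} → (∀ i → f i ≤ g i) → sumFin f ≤ sumFin g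
sum-mono-≤ {zero}  f≤g = ≤-refl
sum-mono-≤ {suc k} f≤g = +-mono-≤ (f≤g zero) (sum-mono-≤ (λ i → f≤g (suc i)))

0≤sum : ∀ {k} {f : Fin k → ℚ} → (∀ i → 0ℚ ≤ f i) → 0ℚ ≤ sumFin f
0≤sum {k} 0≤f = ≤-trans (≤-reflexive (sym (sum-zero k))) (sum-mono-≤ 0≤f)

term≤sum : ∀ {k} {f : Fin k → ℚ} → (∀ i → 0ℚ ≤ f i) → ∀ j → f j ≤ sumFin f
term≤sum {suc k} {f} 0≤f zero    = begin
  f zero                             ≡⟨ sym (+-identityʳ (f zero)) ⟩
  f zero + 0ℚ                        ≤⟨ +-monoʳ-≤ (f zero) (0≤sum (λ i → 0≤f (suc i))) ⟩
  f zero + sumFin (λ i → f (suc i))  ∎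
term≤sum {suc k} {f} 0≤f (suc j) = begin
  f (suc j)                          ≡⟨ sym (+-identityˡ (f (suc j))) ⟩
  0ℚ + f (suc j)                     ≤⟨ +-mono-≤ (0≤f zero) (term≤sum (λ i → 0≤f (suc i)) j) ⟩
  f zero + sumFin (λ i → f (suc i))  ∎

sum≡0⇒≡0 : ∀ {k} {f : Fin k → ℚ} → (∀ i → 0ℚ ≤ f i) → sumFin f ≡ 0ℚ → ∀ i → f i ≡ 0ℚ
sum≡0⇒≡0 0≤f sum≡0 i = ≤-antisym (≤-trans (term≤sum 0≤f i) (≤-reflexive sum≡0)) (0≤f i)

sum-≤-≡⇒≡ : ∀ {k} {f g : Fin k → ℚ} → (∀ i → f i ≤ g i) → sumFin f ≡ sumFin g → ∀ i → f i ≡ g i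
sum-≤-≡⇒≡ {f = f} {g} f≤g sums≡ i = sym (x-y≡0⇒x≡y (sum≡0⇒≡0 (λ j → ≤⇒0≤- (f≤g j))
  (trans (sum-distrib-- g f) (trans (cong (λ t → sumFin g - t) sums≡) (+-inverseʳ (sumFin g)))) i))

-- Indicator vectors, Kronecker deltas and pushforwards

ind-0 : ∀ b → ind b 0ℚ ≡ 0ℚ
ind-0 true  = refl
ind-0 false = refl

ind-*-1 : ∀ b q → ind b q ≡ q * ind b 1ℚ
ind-*-1 true  q = sym (*-identityʳ q)
ind-*-1 false q = sym (*-zeroʳ q)

*-ind : ∀ b c q → c * ind b q ≡ ind b (c * q)
*-ind true  c q = refl
*-ind false c q = *-zeroʳ c

ind-+ : ∀ b q r → ind b (q + r) ≡ ind b q + ind b r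
ind-+ true  q r = refl
ind-+ false q r = refl

ind-sum : ∀ {k} b (f : Fin k → ℚ) → ind b (sumFin f) ≡ sumFin (λ i → ind b (f i))
ind-sum     true  f = refl
ind-sum {k} false f = sym (sum-zero k)

ind-mono-≤ : ∀ b {q r} → q ≤ r → ind b q ≤ ind b r
ind-mono-≤ true  q≤r = q≤r
ind-mono-≤ false q≤r = ≤-refl

0≤ind : ∀ b {q} → 0ℚ ≤ q → 0ℚ ≤ ind b q
0≤ind b 0≤q = ≤-trans (≤-reflexive (sym (ind-0 b))) (ind-mono-≤ b 0≤q)

ind-true : ∀ {b} q → b ≡ true → ind b q ≡ q
ind-true q refl = refl

ind-false : ∀ {b} q → b ≡ false → ind b q ≡ 0ℚ
ind-false q refl = refl

ifEq : ∀ {k} → Fin k → Fin k → ℚ → ℚ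
ifEq i j = ind (does (i Fin.≟ j))

ifEq-refl : ∀ {k} (i : Fin k) q → ifEq i i q ≡ q
ifEq-refl i q = ind-true q (dec-true (i Fin.≟ i) refl)

ifEq-≢ : ∀ {k} {i j : Fin k} q → i ≢ j → ifEq i j q ≡ 0ℚ
ifEq-≢ {i = i} {j} q i≢j = ind-false q (dec-false (i Fin.≟ j) i≢j)

sum-ifEq : ∀ {k} (j : Fin k) (f : Fin k → ℚ) → sumFin (λ i → ifEq j i (f i)) ≡ f j
sum-ifEq j f = trans (sum-single (λ i → ifEq j i (f i)) j (λ i i≢j → ifEq-≢ (f i) (i≢j ∘ sym)))
                     (ifEq-refl j (f j))

δ : ∀ {k} → Fin k → Fin k → ℚ
δ j i = ifEq j i 1ℚ

0≤δ : ∀ {k} (j i : Fin k) → 0ℚ ≤ δ j i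
0≤δ j i = 0≤ind (does (j Fin.≟ i)) 0≤1

sum-δ : ∀ {k} (j : Fin k) → sumFin (δ j) ≡ 1ℚ
sum-δ j = sum-ifEq j (λ _ → 1ℚ)

sum-δ-* : ∀ {k} (j : Fin k) (f : Fin k → ℚ) → sumFin (λ i → δ j i * f i) ≡ f j
sum-δ-* j f = trans (sum-cong (λ i → trans (*-comm (δ j i) (f i)) (sym (ind-*-1 (does (j Fin.≟ i)) (f i)))))
                    (sum-ifEq j f)

pushforward : ∀ {k m} → (Fin k → Fin m) → (Fin k → ℚ) → Fin m → ℚ
pushforward h β i = sumFin (λ s → ifEq (h s) i (β s))

sum-pushforward-* : ∀ {k m} (h : Fin k → Fin m) (β : Fin k → ℚ) (g : Fin m → ℚ) →
                    sumFin (λ i → pushforward h β i * g i) ≡ sumFin (λ s → β s * g (h s))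
sum-pushforward-* h β g = begin-equality
  sumFin (λ i → pushforward h β i * g i)
    ≡⟨ sum-cong (λ i → *-distribʳ-sum (g i) (λ s → ifEq (h s) i (β s))) ⟩
  sumFin (λ i → sumFin (λ s → ifEq (h s) i (β s) * g i))
    ≡⟨ sum-comm (λ i s → ifEq (h s) i (β s) * g i) ⟩
  sumFin (λ s → sumFin (λ i → ifEq (h s) i (β s) * g i))
    ≡⟨ sum-cong (λ s → sum-cong (λ i → trans (*-comm _ (g i)) (*-ind (does (h s Fin.≟ i)) (g i) (β s)))) ⟩
  sumFin (λ s → sumFin (λ i → ifEq (h s) i (g i * β s)))
    ≡⟨ sum-cong (λ s → trans (sum-ifEq (h s) (λ i → g i * β s)) (*-comm (g (h s)) (β s))) ⟩
  sumFin (λ s → β s * g (h s)) ∎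

sum-pushforward : ∀ {k m} (h : Fin k → Fin m) (β : Fin k → ℚ) → sumFin (pushforward h β) ≡ sumFin β
sum-pushforward h β = begin-equality
  sumFin (pushforward h β)                  ≡⟨ sum-cong (λ i → *-identityʳ (pushforward h β i)) ⟨
  sumFin (λ i → pushforward h β i * 1ℚ)     ≡⟨ sum-pushforward-* h β (λ _ → 1ℚ) ⟩
  sumFin (λ s → β s * 1ℚ)                   ≡⟨ sum-cong (λ s → *-identityʳ (β s)) ⟩
  sumFin β                                  ∎

0≤pushforward : ∀ {k m} (h : Fin k → Fin m) {β : Fin k → ℚ} → (∀ s → 0ℚ ≤ β s) → ∀ i → 0ℚ ≤ pushforward h β i
0≤pushforward h 0≤β i = 0≤sum (λ s → 0≤ind (does (h s Fin.≟ i)) (0≤β s))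

≤-pushforward : ∀ {k m} (h : Fin k → Fin m) {β : Fin k → ℚ} → (∀ s → 0ℚ ≤ β s) → ∀ s → β s ≤ pushforward h β (h s)
≤-pushforward h {β} 0≤β s = begin
  β s                        ≡⟨ ifEq-refl (h s) (β s) ⟨
  ifEq (h s) (h s) (β s)     ≤⟨ term≤sum (λ s′ → 0≤ind (does (h s′ Fin.≟ h s)) (0≤β s′)) s ⟩
  pushforward h β (h s)      ∎

pushforward-fibre : ∀ {k m} (h : Fin k → Fin m) (β : Fin k → ℚ) s →
                    (∀ s′ → s′ ≢ s → h s′ ≡ h s → β s′ ≡ 0ℚ) → pushforward h β (h s) ≡ β s
pushforward-fibre h β s β≡0 = trans (sum-single _ s term≡0) (ifEq-refl (h s) (β s))
  where
  term≡0 : ∀ s′ → s′ ≢ s → ifEq (h s′) (h s) (β s′) ≡ 0ℚ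
  term≡0 s′ s′≢s with h s′ Fin.≟ h s
  ... | yes h≡ = β≡0 s′ s′≢s h≡
  ... | no  _  = refl

pushforward-∉image : ∀ {k m} (h : Fin k → Fin m) (β : Fin k → ℚ) i → (∀ s → h s ≢ i) → pushforward h β i ≡ 0ℚ
pushforward-∉image {k} h β i ∉image = trans (sum-cong (λ s → ifEq-≢ (β s) (∉image s))) (sum-zero k)

∉⇒lookup≡false : ∀ {n} {D : Subset n} {a} → a ∉ D → lookup D a ≡ false
∉⇒lookup≡false {D = D} {a} a∉D with lookup D a in eq
... | true  = ⊥-elim (a∉D (lookup⇒[]= a D eq))
... | false = refl

ind-∈ : ∀ {n} {D : Subset n} {a} q → a ∈ D → ind (lookup D a) q ≡ q
ind-∈ q a∈D = ind-true q ([]=⇒lookup a∈D)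

ind-∉ : ∀ {n} {D : Subset n} {a} q → a ∉ D → ind (lookup D a) q ≡ 0ℚ
ind-∉ q a∉D = ind-false q (∉⇒lookup≡false a∉D)

level-set : ∀ {n} → (Fin n → ℚ) → ℚ → Subset n
level-set x v = tabulate (λ a → does (x a ≟ v))

∈-level-set⁺ : ∀ {n} {x : Fin n → ℚ} {v a} → x a ≡ v → a ∈ level-set x v
∈-level-set⁺ {x = x} {v} {a} xa≡v =
  lookup⇒[]= a (level-set x v) (trans (lookup∘tabulate _ a) (dec-true (x a ≟ v) xa≡v))

∈-level-set⁻ : ∀ {n} {x : Fin n → ℚ} {v a} → a ∈ level-set x v → x a ≡ v
∈-level-set⁻ {x = x} {v} {a} a∈ with x a ≟ v | trans (sym (lookup∘tabulate (λ b → does (x b ≟ v)) a)) ([]=⇒lookup a∈)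
... | yes xa≡v | _ = xa≡v
... | no  _    | ()

𝟙 : ∀ {n} → Subset n → Fin n → ℚ
𝟙 D a = ind (lookup D a) 1ℚ

0≤𝟙 : ∀ {n} (D : Subset n) a → 0ℚ ≤ 𝟙 D a
0≤𝟙 D a = 0≤ind (lookup D a) 0≤1

𝟙-injective-⊆ : ∀ {n} {A B : Subset n} → (∀ a → 𝟙 A a ≡ 𝟙 B a) → A ⊆ B
𝟙-injective-⊆ {A = A} {B} 𝟙A≗𝟙B {a} a∈A with lookup B a in eq
... | true  = lookup⇒[]= a B eq
... | false = ⊥-elim (1≢0 (trans (sym (ind-∈ {D = A} 1ℚ a∈A)) (trans (𝟙A≗𝟙B a) (ind-false 1ℚ eq))))

card≡sum𝟙 : ∀ {n} (D : Subset n) → ℕtoℚ ∣ D ∣ ≡ sumFin (𝟙 D)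
card≡sum𝟙 Vec.[]            = refl
card≡sum𝟙 (true  Vec.∷ D) = trans (ℕtoℚ-suc ∣ D ∣) (cong (1ℚ +_) (card≡sum𝟙 D))
card≡sum𝟙 (false Vec.∷ D) = trans (card≡sum𝟙 D) (sym (+-identityˡ _))

module _ {n : ℕ} where

  dot-cong : ∀ {x z : Fin n → ℚ} D → (∀ a → x a ≡ z a) → dot x D ≡ dot z D
  dot-cong D x≗z = sum-cong (λ a → cong (ind (lookup D a)) (x≗z a))

  dot-mono-≤ : ∀ {x z : Fin n → ℚ} D → (∀ a → x a ≤ z a) → dot x D ≤ dot z D
  dot-mono-≤ D x≤z = sum-mono-≤ (λ a → ind-mono-≤ (lookup D a) (x≤z a))

  coordinate≤dot : ∀ {x : Fin n → ℚ} D → (∀ a → 0ℚ ≤ x a) → ∀ {a} → a ∈ D → x a ≤ dot x D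
  coordinate≤dot {x} D 0≤x {a} a∈D = begin
    x a                   ≡⟨ ind-∈ {D = D} (x a) a∈D ⟨
    ind (lookup D a) (x a) ≤⟨ term≤sum (λ b → 0≤ind (lookup D b) (0≤x b)) a ⟩
    dot x D               ∎

  dot-+ : ∀ (x z : Fin n → ℚ) D → dot (λ a → x a + z a) D ≡ dot x D + dot z D
  dot-+ x z D = trans (sum-cong (λ a → ind-+ (lookup D a) (x a) (z a))) (sum-distrib-+ (λ a → ind (lookup D a) (x a)) (λ a → ind (lookup D a) (z a)))

  dot-- : ∀ (x z : Fin n → ℚ) D → dot (λ a → x a - z a) D ≡ dot x D - dot z D
  dot-- x z D = trans (sum-cong (λ a → lemma (lookup D a))) (sum-distrib-- (λ a → ind (lookup D a) (x a)) (λ a → ind (lookup D a) (z a)))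
    where
    lemma : ∀ b {a} → ind b (x a - z a) ≡ ind b (x a) - ind b (z a)
    lemma true  = refl
    lemma false = refl

  *-dot : ∀ c (x : Fin n → ℚ) D → c * dot x D ≡ dot (λ a → c * x a) D
  *-dot c x D = trans (*-distribˡ-sum c (λ a → ind (lookup D a) (x a))) (sum-cong (λ a → *-ind (lookup D a) c (x a)))

  dot-sum : ∀ {k} (f : Fin k → Fin n → ℚ) D → dot (λ a → sumFin (λ j → f j a)) D ≡ sumFin (λ j → dot (f j) D)
  dot-sum f D = trans (sum-cong (λ a → ind-sum (lookup D a) (λ j → f j a))) (sum-comm (λ a j → ind (lookup D a) (f j a)))

  dot-const : ∀ c (D : Subset n) → dot (λ _ → c) D ≡ c * ℕtoℚ ∣ D ∣
  dot-const c D = begin-equality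
    dot (λ _ → c) D    ≡⟨ sum-cong (λ a → ind-*-1 (lookup D a) c) ⟩
    sumFin (λ a → c * 𝟙 D a) ≡⟨ *-distribˡ-sum c (𝟙 D) ⟨
    c * sumFin (𝟙 D)   ≡⟨ cong (c *_) (card≡sum𝟙 D) ⟨
    c * ℕtoℚ ∣ D ∣     ∎

  dot-vanishing : ∀ {x : Fin n → ℚ} D → (∀ {a} → a ∈ D → x a ≡ 0ℚ) → dot x D ≡ 0ℚ
  dot-vanishing {x} D x≡0 = trans (sum-cong term≡0) (sum-zero n)
    where
    term≡0 : ∀ a → ind (lookup D a) (x a) ≡ 0ℚ
    term≡0 a with a Subset.∈? D
    ... | yes a∈D = trans (ind-∈ {D = D} (x a) a∈D) (x≡0 a∈D)
    ... | no  a∉D = ind-∉ {D = D} (x a) a∉D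

  meets⇒1≤dot𝟙 : ∀ {D H : Subset n} → ∃[ a ] (a ∈ D × a ∈ H) → 1ℚ ≤ dot (𝟙 H) D
  meets⇒1≤dot𝟙 {D} {H} (a , a∈D , a∈H) =
    ≤-trans (≤-reflexive (sym (ind-∈ {D = H} 1ℚ a∈H))) (coordinate≤dot D (0≤𝟙 H) a∈D)

-- Convex hulls and perturbations

module _ {n k : ℕ} (p : Fin k → Fin n → ℚ) where

  InConv-vertex : ∀ j → InConv p (p j)
  InConv-vertex j = δ j , 0≤δ j , sum-δ j , (λ a → sym (sum-δ-* j (λ l → p l a)))

  InConv⇒≤sum : (∀ j a → 0ℚ ≤ p j a) → ∀ {x} → InConv p x → ∀ a → x a ≤ sumFin (λ j → p j a)
  InConv⇒≤sum 0≤p {x} (w , 0≤w , sum≡1 , x≗) a = begin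
    x a                                ≡⟨ x≗ a ⟩
    sumFin (λ j → w j * p j a)        ≤⟨ sum-mono-≤ (λ j → *-monoˡ-≤-nonNeg (w j) {{nonNegative (0≤w j)}}
                                            (term≤sum (λ l → 0≤p l a) j)) ⟩
    sumFin (λ j → w j * M)            ≡⟨ *-distribʳ-sum M w ⟨
    sumFin w * M                      ≡⟨ cong (_* M) sum≡1 ⟩
    1ℚ * M                             ≡⟨ *-identityˡ M ⟩
    M                                  ∎
    where M = sumFin (λ j → p j a)

  dot-InConv : ∀ {x} (w : Fin k → ℚ) → (∀ a → x a ≡ sumFin (λ j → w j * p j a)) →
               ∀ D → dot x D ≡ sumFin (λ j → w j * dot (p j) D)
  dot-InConv {x} w x≗ D = begin-equality
    dot x D                                          ≡⟨ dot-cong D x≗ ⟩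
    dot (λ a → sumFin (λ j → w j * p j a)) D         ≡⟨ dot-sum (λ j a → w j * p j a) D ⟩
    sumFin (λ j → dot (λ a → w j * p j a) D)         ≡⟨ sum-cong (λ j → *-dot (w j) (p j) D) ⟨
    sumFin (λ j → w j * dot (p j) D)                 ∎

  InConv-shift : ∀ {x z : Fin n → ℚ} {e} l → 0ℚ < e → InConv p z →
                 (∀ a → (1ℚ + e) * x a ≡ z a + e * p l a) → Σ (InConv p x) (λ x∈ → 0ℚ < proj₁ x∈ l)
  InConv-shift {x} {z} {e} l 0<e (w , 0≤w , sum-w≡1 , z≗) [1+e]x≗ = (β , 0≤β , sum-β≡1 , x≗) , 0<βl
    where
    0<1+e : 0ℚ < 1ℚ + e
    0<1+e = +-mono-< 0<1 0<e
    instance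
      1+e≢0 : NonZero (1ℚ + e)
      1+e≢0 = pos⇒nonZero (1ℚ + e) {{positive 0<1+e}}
    γ : ℚ
    γ = 1/ (1ℚ + e)
    γ[1+e]≡1 : γ * (1ℚ + e) ≡ 1ℚ
    γ[1+e]≡1 = *-inverseˡ (1ℚ + e)
    0<γ : 0ℚ < γ
    0<γ = positive⁻¹ γ {{1/pos⇒pos (1ℚ + e) {{positive 0<1+e}}}}
    β : Fin k → ℚ
    β s = γ * (w s + e * δ l s)
    0≤β : ∀ s → 0ℚ ≤ β s
    0≤β s = 0≤* (<⇒≤ 0<γ) (+-mono-≤ (0≤w s) (0≤* (<⇒≤ 0<e) (0≤δ l s)))
    Σβ-expansion : ∀ (f : Fin k → ℚ) → sumFin (λ s → β s * f s) ≡ γ * (sumFin (λ s → w s * f s) + e * f l)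
    Σβ-expansion f = begin-equality
      sumFin (λ s → β s * f s)
        ≡⟨ sum-cong (λ s → trans (*-assoc γ _ (f s)) (cong (γ *_) (trans (*-distribʳ-+ (f s) (w s) _) (cong (w s * f s +_) (*-assoc e (δ l s) (f s)))))) ⟩
      sumFin (λ s → γ * (w s * f s + e * (δ l s * f s)))
        ≡⟨ *-distribˡ-sum γ (λ s → w s * f s + e * (δ l s * f s)) ⟨
      γ * sumFin (λ s → w s * f s + e * (δ l s * f s))
        ≡⟨ cong (γ *_) (sum-distrib-+ (λ s → w s * f s) (λ s → e * (δ l s * f s))) ⟩
      γ * (sumFin (λ s → w s * f s) + sumFin (λ s → e * (δ l s * f s)))
        ≡⟨ cong (λ t → γ * (sumFin (λ s → w s * f s) + t))
             (trans (sym (*-distribˡ-sum e (λ s → δ l s * f s))) (cong (e *_) (sum-δ-* l f))) ⟩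
      γ * (sumFin (λ s → w s * f s) + e * f l) ∎
    sum-β≡1 : sumFin β ≡ 1ℚ
    sum-β≡1 = begin-equality
      sumFin β                              ≡⟨ sum-cong (λ s → *-identityʳ (β s)) ⟨
      sumFin (λ s → β s * 1ℚ)               ≡⟨ Σβ-expansion (λ _ → 1ℚ) ⟩
      γ * (sumFin (λ s → w s * 1ℚ) + e * 1ℚ) ≡⟨ cong₂ (λ u v → γ * (u + v)) (trans (sum-cong (λ s → *-identityʳ (w s))) sum-w≡1) (*-identityʳ e) ⟩
      γ * (1ℚ + e)                          ≡⟨ γ[1+e]≡1 ⟩
      1ℚ                                    ∎
    x≗ : ∀ a → x a ≡ sumFin (λ s → β s * p s a)
    x≗ a = begin-equality
      x a                                            ≡⟨ *-identityˡ (x a) ⟨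
      1ℚ * x a                                       ≡⟨ cong (_* x a) γ[1+e]≡1 ⟨
      γ * (1ℚ + e) * x a                             ≡⟨ *-assoc γ (1ℚ + e) (x a) ⟩
      γ * ((1ℚ + e) * x a)                           ≡⟨ cong (γ *_) ([1+e]x≗ a) ⟩
      γ * (z a + e * p l a)                          ≡⟨ cong (λ t → γ * (t + e * p l a)) (z≗ a) ⟩
      γ * (sumFin (λ s → w s * p s a) + e * p l a)    ≡⟨ Σβ-expansion (λ s → p s a) ⟨
      sumFin (λ s → β s * p s a)                     ∎
    0<βl : 0ℚ < β l
    0<βl = 0<* 0<γ (begin-strict
      0ℚ                   ≤⟨ 0≤w l ⟩
      w l                  ≡⟨ +-identityʳ (w l) ⟨
      w l + 0ℚ             <⟨ +-monoʳ-< (w l) 0<e ⟩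
      w l + e              ≡⟨ cong (λ t → w l + t) (trans (cong (e *_) (ifEq-refl l 1ℚ)) (*-identityʳ e)) ⟨
      w l + e * δ l l      ∎)

InConv⇒index : ∀ {n k} {p : Fin k → Fin n → ℚ} {x} → InConv p x → Fin k
InConv⇒index {k = zero}  (_ , _ , sum≡1 , _) = ⊥-elim (1≢0 (sym sum≡1))
InConv⇒index {k = suc k} _                   = zero

record Enumeration {m : ℕ} (P : Fin m → Set) : Set where
  field
    size      : ℕ
    index     : Fin size → Fin m
    injective : Injective _≡_ _≡_ index
    sound     : ∀ j → P (index j)
    complete  : ∀ i → P i → ∃[ j ] index j ≡ i

enumerate : ∀ {m} {P : Fin m → Set} → (∀ i → Dec (P i)) → Enumeration P
enumerate {zero} P? = record { size = 0 ; index = λ () ; injective = λ {} ; sound = λ () ; complete = λ () }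
enumerate {suc m} {P} P? with enumerate (P? ∘ suc) | P? zero
... | E | no ¬P0 = record
  { size      = size
  ; index     = suc ∘ index
  ; injective = injective ∘ Fin.suc-injective
  ; sound     = sound
  ; complete  = λ { zero P0 → ⊥-elim (¬P0 P0)
                  ; (suc i) Pi → let j , eq = complete i Pi in j , cong suc eq }
  }
  where open Enumeration E
... | E | yes P0 = record
  { size      = suc size
  ; index     = index′
  ; injective = injective′
  ; sound     = λ { zero → P0 ; (suc j) → sound j }
  ; complete  = λ { zero _ → zero , refl
                  ; (suc i) Pi → let j , eq = complete i Pi in suc j , cong suc eq }
  }
  where
  open Enumeration E
  index′ : Fin (suc size) → Fin (suc m)
  index′ zero    = zero
  index′ (suc j) = suc (index j)
  injective′ : Injective _≡_ _≡_ index′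
  injective′ {zero}  {zero}  _  = refl
  injective′ {suc j} {suc j′} eq = cong suc (injective (Fin.suc-injective eq))

private
  StepFeasible : ℚ → ℚ → ℚ → Set
  StepFeasible a b ε = ∀ d → 0ℚ ≤ d → d ≤ ε → 0ℚ ≤ a + d * b

  coordinate-step : ∀ a b → 0ℚ ≤ a → (¬ 0ℚ < a → b ≡ 0ℚ) → ∃[ ε ] (0ℚ < ε × StepFeasible a b ε)
  coordinate-step a b 0≤a b≡0 with 0ℚ ≤? b
  ... | yes 0≤b = 1ℚ , 0<1 , λ d 0≤d _ → +-mono-≤ 0≤a (0≤* 0≤d 0≤b)
  ... | no  0≰b = ε , 0<* 0<a (positive⁻¹ (1/ (- b)) {{1/pos⇒pos (- b)}}) , feasible
    where
    b<0 : b < 0ℚ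
    b<0 = ≰⇒> 0≰b
    0<a : 0ℚ < a
    0<a with 0ℚ <? a
    ... | yes 0<a = 0<a
    ... | no  0≮a = ⊥-elim (0≰b (≤-reflexive (sym (b≡0 0≮a))))
    instance
      -b-pos : Positive (- b)
      -b-pos = positive (neg-antimono-< b<0)
      -b≢0 : NonZero (- b)
      -b≢0 = pos⇒nonZero (- b)
    ε : ℚ
    ε = a * 1/ (- b)
    feasible : StepFeasible a b ε
    feasible d 0≤d d≤ε = begin
      0ℚ               ≤⟨ ≤⇒0≤- d*-b≤a ⟩
      a - d * (- b)    ≡⟨ solve (a ∷ d ∷ b ∷ []) ℚ-ring ⟩
      a + d * b        ∎
      where
      d*-b≤a : d * (- b) ≤ a
      d*-b≤a = begin
        d * (- b)              ≤⟨ *-monoʳ-≤-nonNeg (- b) {{pos⇒nonNeg (- b)}} d≤ε ⟩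
        a * 1/ (- b) * (- b)   ≡⟨ *-assoc a (1/ (- b)) (- b) ⟩
        a * (1/ (- b) * (- b)) ≡⟨ cong (a *_) (*-inverseˡ (- b)) ⟩
        a * 1ℚ                 ≡⟨ *-identityʳ a ⟩
        a                      ∎

∃-feasible-step : ∀ {m} (a b : Fin m → ℚ) → (∀ i → 0ℚ ≤ a i) → (∀ i → ¬ 0ℚ < a i → b i ≡ 0ℚ) →
                  ∃[ ε ] (0ℚ < ε × ∀ i → 0ℚ ≤ a i + ε * b i)
∃-feasible-step a b 0≤a b≡0 = let ε , 0<ε , feasible = uniform a b 0≤a b≡0 in
  ε , 0<ε , λ i → feasible i ε (<⇒≤ 0<ε) ≤-refl
  where
  uniform : ∀ {m} (a b : Fin m → ℚ) → (∀ i → 0ℚ ≤ a i) → (∀ i → ¬ 0ℚ < a i → b i ≡ 0ℚ) →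
            ∃[ ε ] (0ℚ < ε × ∀ i → StepFeasible (a i) (b i) ε)
  uniform {zero}  a b _   _   = 1ℚ , 0<1 , λ ()
  uniform {suc m} a b 0≤a b≡0 with coordinate-step (a zero) (b zero) (0≤a zero) (b≡0 zero)
                                 | uniform (a ∘ suc) (b ∘ suc) (0≤a ∘ suc) (b≡0 ∘ suc)
  ... | ε₀ , 0<ε₀ , feasible₀ | ε₁ , 0<ε₁ , feasible₁ = ε₀ ⊓ ε₁ , 0<⊓ , feasible
    where
    0<⊓ : 0ℚ < ε₀ ⊓ ε₁
    0<⊓ with ⊓-sel ε₀ ε₁
    ... | inj₁ ⊓≡ε₀ = subst (0ℚ <_) (sym ⊓≡ε₀) 0<ε₀
    ... | inj₂ ⊓≡ε₁ = subst (0ℚ <_) (sym ⊓≡ε₁) 0<ε₁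
    feasible : ∀ i → StepFeasible (a i) (b i) (ε₀ ⊓ ε₁)
    feasible zero    d 0≤d d≤ε = feasible₀ d 0≤d (≤-trans d≤ε (p⊓q≤p ε₀ ε₁))
    feasible (suc i) d 0≤d d≤ε = feasible₁ i d 0≤d (≤-trans d≤ε (p⊓q≤q ε₀ ε₁))

-- Transversals and packings

⊈⇒∃∈∉ : ∀ {n} {A B : Subset n} → ¬ A ⊆ B → ∃[ a ] (a ∈ A × a ∉ B)
⊈⇒∃∈∉ {n} {A} {B} A⊈B with Fin.¬∀⟶∃¬ n _ (λ a → a Subset.∈? A →-dec a Subset.∈? B) (λ A⊆B → A⊈B (A⊆B _))
... | a , ¬[a∈A→a∈B] with a Subset.∈? A
...   | yes a∈A = a , a∈A , (λ a∈B → ¬[a∈A→a∈B] (λ _ → a∈B))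
...   | no  a∉A = ⊥-elim (¬[a∈A→a∈B] (λ a∈A → ⊥-elim (a∉A a∈A)))

⊂⇒∣∣< : ∀ {n} {A B : Subset n} → A ⊆ B → A ≢ B → ∣ A ∣ ℕ.< ∣ B ∣
⊂⇒∣∣< A⊆B A≢B = Subset.p⊂q⇒∣p∣<∣q∣ (A⊆B , ⊈⇒∃∈∉ (λ B⊆A → A≢B (Subset.⊆-antisym A⊆B B⊆A)))

module _ {n m : ℕ} (C : Fin m → Subset n) where

  -- Only ¬¬: whether a cover is already inclusion-minimal is not decidable here.
  cover⇒¬¬transversal⊆ : ∀ D → IsCover C D → ¬ ¬ (∃[ T ] (T ⊆ D × IsTransversal C T))
  cover⇒¬¬transversal⊆ D = go D (ℕ.<-wellFounded ∣ D ∣)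
    where
    go : ∀ D → Acc ℕ._<_ ∣ D ∣ → IsCover C D → ¬ ¬ (∃[ T ] (T ⊆ D × IsTransversal C T))
    go D (acc rec) D-covers ¬T = ¬T (D , (λ a∈D → a∈D) , D-covers , minimal)
      where
      minimal : ∀ D′ → D′ ⊆ D → IsCover C D′ → D′ ≡ D
      minimal D′ D′⊆D D′-covers = decidable-stable (Vec.≡-dec Bool._≟_ D′ D) λ D′≢D →
        go D′ (rec (⊂⇒∣∣< D′⊆D D′≢D)) D′-covers
          (λ (T , T⊆D′ , T-transversal) → ¬T (T , D′⊆D ∘ T⊆D′ , T-transversal))

  clutter⇒𝟙-injective : IsClutter C → ∀ i j → (∀ a → 𝟙 (C i) a ≡ 𝟙 (C j) a) → i ≡ j
  clutter⇒𝟙-injective clutter i j 𝟙Ci≗𝟙Cj with i Fin.≟ j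
  ... | yes i≡j = i≡j
  ... | no  i≢j = ⊥-elim (clutter i j i≢j (𝟙-injective-⊆ 𝟙Ci≗𝟙Cj))

module _ {n m : ℕ} (C : Fin m → Subset n) where

  load : (Fin m → ℚ) → Fin n → ℚ
  load y a = sumFin (λ i → ind (lookup (C i) a) (y i))

  load-as-sum : ∀ y a → load y a ≡ sumFin (λ i → y i * 𝟙 (C i) a)
  load-as-sum y a = sum-cong (λ i → ind-*-1 (lookup (C i) a) (y i))

  load-difference : ∀ y y′ a → load y a - load y′ a ≡ sumFin (λ i → (y i - y′ i) * 𝟙 (C i) a)
  load-difference y y′ a = begin-equality
    load y a - load y′ a
      ≡⟨ cong₂ _-_ (load-as-sum y a) (load-as-sum y′ a) ⟩
    sumFin (λ i → y i * 𝟙 (C i) a) - sumFin (λ i → y′ i * 𝟙 (C i) a)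
      ≡⟨ sum-distrib-- (λ i → y i * 𝟙 (C i) a) (λ i → y′ i * 𝟙 (C i) a) ⟨
    sumFin (λ i → y i * 𝟙 (C i) a - y′ i * 𝟙 (C i) a)
      ≡⟨ sum-cong (λ i → sym (*-distribʳ-- (𝟙 (C i) a) (y i) (y′ i))) ⟩
    sumFin (λ i → (y i - y′ i) * 𝟙 (C i) a) ∎

  load-+-* : ∀ y ν e a → load (λ i → y i + e * ν i) a ≡ load y a + e * load ν a
  load-+-* y ν e a = begin-equality
    load (λ i → y i + e * ν i) a
      ≡⟨ sum-cong (λ i → ind-+ (lookup (C i) a) (y i) (e * ν i)) ⟩
    sumFin (λ i → ind (lookup (C i) a) (y i) + ind (lookup (C i) a) (e * ν i))
      ≡⟨ sum-distrib-+ (λ i → ind (lookup (C i) a) (y i)) (λ i → ind (lookup (C i) a) (e * ν i)) ⟩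
    load y a + sumFin (λ i → ind (lookup (C i) a) (e * ν i))
      ≡⟨ cong (load y a +_) (trans (sum-cong (λ i → sym (*-ind (lookup (C i) a) e (ν i))))
                                   (sym (*-distribˡ-sum e (λ i → ind (lookup (C i) a) (ν i))))) ⟩
    load y a + e * load ν a ∎

  double-counting : ∀ y D → sumFin (λ i → y i * dot (𝟙 (C i)) D) ≡ dot (load y) D
  double-counting y D = begin-equality
    sumFin (λ i → y i * dot (𝟙 (C i)) D)                 ≡⟨ sum-cong (λ i → *-dot (y i) (𝟙 (C i)) D) ⟩
    sumFin (λ i → dot (λ a → y i * 𝟙 (C i) a) D)        ≡⟨ dot-sum (λ i a → y i * 𝟙 (C i) a) D ⟨
    dot (λ a → sumFin (λ i → y i * 𝟙 (C i) a)) D        ≡⟨ dot-cong D (λ a → sym (load-as-sum y a)) ⟩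
    dot (load y) D                                      ∎

  complementary-slackness : ∀ {y D} → IsPacking C y → IsCover C D → sumFin y ≡ ℕtoℚ ∣ D ∣ →
    (∀ {a} → a ∈ D → load y a ≡ 1ℚ) × (∀ i → 0ℚ < y i → dot (𝟙 (C i)) D ≡ 1ℚ)
  complementary-slackness {y} {D} (0≤y , load≤1) D-covers sum≡∣D∣ = load≡1 , dot≡1
    where
    d : Fin m → ℚ
    d i = dot (𝟙 (C i)) D
    y≤yd : ∀ i → y i ≤ y i * d i
    y≤yd i = begin
      y i        ≡⟨ *-identityʳ (y i) ⟨
      y i * 1ℚ   ≤⟨ *-monoˡ-≤-nonNeg (y i) {{nonNegative (0≤y i)}} (meets⇒1≤dot𝟙 (D-covers i)) ⟩
      y i * d i  ∎
    load≤𝟙 : ∀ a → ind (lookup D a) (load y a) ≤ 𝟙 D a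
    load≤𝟙 a = ind-mono-≤ (lookup D a) (load≤1 a)
    Σyd≡Σload : sumFin (λ i → y i * d i) ≡ dot (load y) D
    Σyd≡Σload = double-counting y D
    Σ𝟙≡Σy : sumFin (𝟙 D) ≡ sumFin y
    Σ𝟙≡Σy = trans (sym (card≡sum𝟙 D)) (sym sum≡∣D∣)
    Σy≡Σyd : sumFin y ≡ sumFin (λ i → y i * d i)
    Σy≡Σyd = ≤-antisym (sum-mono-≤ y≤yd)
      (≤-trans (≤-reflexive Σyd≡Σload) (≤-trans (sum-mono-≤ load≤𝟙) (≤-reflexive Σ𝟙≡Σy)))
    Σload≡Σ𝟙 : dot (load y) D ≡ sumFin (𝟙 D)
    Σload≡Σ𝟙 = ≤-antisym (sum-mono-≤ load≤𝟙)
      (≤-trans (≤-reflexive Σ𝟙≡Σy) (≤-trans (sum-mono-≤ y≤yd) (≤-reflexive Σyd≡Σload)))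
    load≡1 : ∀ {a} → a ∈ D → load y a ≡ 1ℚ
    load≡1 {a} a∈D = begin-equality
      load y a                         ≡⟨ ind-∈ {D = D} (load y a) a∈D ⟨
      ind (lookup D a) (load y a)      ≡⟨ sum-≤-≡⇒≡ load≤𝟙 Σload≡Σ𝟙 a ⟩
      𝟙 D a                            ≡⟨ ind-∈ {D = D} 1ℚ a∈D ⟩
      1ℚ                               ∎
    dot≡1 : ∀ i → 0ℚ < y i → d i ≡ 1ℚ
    dot≡1 i 0<yi = x-y≡0⇒x≡y (0<∧*≡0⇒≡0 0<yi (begin-equality
      y i * (d i - 1ℚ)     ≡⟨ x*[y-1]≡x*y-x (y i) (d i) ⟩
      y i * d i - y i      ≡⟨ cong (_- y i) (sum-≤-≡⇒≡ y≤yd Σy≡Σyd i) ⟨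
      y i - y i            ≡⟨ +-inverseʳ (y i) ⟩
      0ℚ                   ∎))

-- The polytope I(C)

module Blocking {n m : ℕ} (C : Fin m → Subset n) (blocking : IntegralBlocking C) where

  y₀ : Fin m → ℚ
  y₀ = proj₁ blocking

  D₀ : Subset n
  D₀ = proj₁ (proj₂ blocking)

  y₀-max : IsMaxPacking C y₀
  y₀-max = proj₁ (proj₂ (proj₂ blocking))

  D₀-min : IsMinTransversal C D₀
  D₀-min = proj₁ (proj₂ (proj₂ (proj₂ blocking)))

  -- Kept opaque: unfolding ℕtoℚ ∣ D₀ ∣ during unification is prohibitively expensive.
  opaque
    τ : ℚ
    τ = ℕtoℚ ∣ D₀ ∣

    τ≡ℕtoℚ∣D₀∣ : τ ≡ ℕtoℚ ∣ D₀ ∣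
    τ≡ℕtoℚ∣D₀∣ = refl

  maxPacking-sum : ∀ {y} → IsMaxPacking C y → sumFin y ≡ τ
  maxPacking-sum {y} (y-packing , y-max) =
    trans (≤-antisym (proj₂ y₀-max y y-packing) (y-max y₀ (proj₁ y₀-max)))
          (trans (proj₂ (proj₂ (proj₂ (proj₂ blocking)))) (sym τ≡ℕtoℚ∣D₀∣))

  maxPacking-intro : ∀ {y} → IsPacking C y → sumFin y ≡ τ → IsMaxPacking C y
  maxPacking-intro {y} y-packing sum≡τ =
    y-packing , λ y′ y′-packing → ≤-trans (proj₂ y₀-max y′ y′-packing) (≤-reflexive (trans (maxPacking-sum y₀-max) (sym sum≡τ)))

  transversal-size : ∀ {D} → IsTransversal C D → ∣ D₀ ∣ ℕ.≤ ∣ D ∣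
  transversal-size = proj₂ D₀-min _

  minTransversal-size : ∀ {D} → IsMinTransversal C D → ∣ D ∣ ≡ ∣ D₀ ∣
  minTransversal-size (D-transversal , D-min) = ℕ.≤-antisym (D-min D₀ (proj₁ D₀-min)) (transversal-size D-transversal)

  minTransversal-intro : ∀ {D} → IsTransversal C D → ∣ D ∣ ℕ.≤ ∣ D₀ ∣ → IsMinTransversal C D
  minTransversal-intro D-transversal ∣D∣≤ = D-transversal , λ D′ D′-transversal → ℕ.≤-trans ∣D∣≤ (transversal-size D′-transversal)

  maxPacking-tight : ∀ {y D} → IsMaxPacking C y → IsMinTransversal C D →
    (∀ {a} → a ∈ D → load C y a ≡ 1ℚ) × (∀ i → 0ℚ < y i → dot (𝟙 (C i)) D ≡ 1ℚ)
  maxPacking-tight y-max D-min = complementary-slackness C (proj₁ y-max) (proj₁ (proj₁ D-min))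
    (trans (maxPacking-sum y-max) (trans τ≡ℕtoℚ∣D₀∣ (cong ℕtoℚ (sym (minTransversal-size D-min)))))

  support-edge∈I : ∀ {y} → IsMaxPacking C y → ∀ i → 0ℚ < y i → I C (𝟙 (C i))
  support-edge∈I y-max i 0<yi = (λ D D-min → proj₂ (maxPacking-tight y-max D-min) i 0<yi)
                              , (λ D D-transversal → meets⇒1≤dot𝟙 (proj₁ D-transversal i))
                              , 0≤𝟙 (C i)

  I-convex : ∀ {k} (q : Fin k → Fin n → ℚ) → (∀ j → I C (q j)) → ∀ {x} → InConv q x → I C x
  I-convex q q∈I {x} (w , 0≤w , sum-w≡1 , x≗) = dot≡1 , 1≤dot , 0≤x
    where
    dot≡1 : ∀ D → IsMinTransversal C D → dot x D ≡ 1ℚ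
    dot≡1 D D-min = begin-equality
      dot x D                             ≡⟨ dot-InConv q w x≗ D ⟩
      sumFin (λ j → w j * dot (q j) D)    ≡⟨ sum-cong (λ j → trans (cong (w j *_) (proj₁ (q∈I j) D D-min)) (*-identityʳ (w j))) ⟩
      sumFin w                            ≡⟨ sum-w≡1 ⟩
      1ℚ                                  ∎
    1≤dot : ∀ D → IsTransversal C D → 1ℚ ≤ dot x D
    1≤dot D D-transversal = begin
      1ℚ                                  ≡⟨ sum-w≡1 ⟨
      sumFin w                            ≤⟨ sum-mono-≤ (λ j → ≤-trans (≤-reflexive (sym (*-identityʳ (w j))))
                                               (*-monoˡ-≤-nonNeg (w j) {{nonNegative (0≤w j)}} (proj₁ (proj₂ (q∈I j)) D D-transversal))) ⟩
      sumFin (λ j → w j * dot (q j) D)    ≡⟨ dot-InConv q w x≗ D ⟨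
      dot x D                             ∎
    0≤x : ∀ a → 0ℚ ≤ x a
    0≤x a = ≤-trans (0≤sum (λ j → 0≤* (0≤w j) (proj₂ (proj₂ (q∈I j)) a))) (≤-reflexive (sym (x≗ a)))

  perturbed-maxPacking : ∀ {y} → IsMaxPacking C y → ∀ ν → sumFin ν ≡ 0ℚ → (∀ a → load C ν a ≡ 0ℚ) →
                         (∀ i → ¬ 0ℚ < y i → ν i ≡ 0ℚ) → ∃[ e ] (0ℚ < e × IsMaxPacking C (λ i → y i + e * ν i))
  perturbed-maxPacking {y} y-max@((0≤y , load≤1) , _) ν sum-ν≡0 load-ν≡0 ν≡0 =
    let e , 0<e , 0≤y+eν = ∃-feasible-step y ν 0≤y ν≡0 in
    e , 0<e , maxPacking-intro (0≤y+eν , λ a → ≤-trans (≤-reflexive (load≡ e a)) (load≤1 a)) (sum≡ e)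
    where
    load≡ : ∀ e a → load C (λ i → y i + e * ν i) a ≡ load C y a
    load≡ e a = trans (load-+-* C y ν e a) (trans (cong (λ t → load C y a + e * t) (load-ν≡0 a))
                  (trans (cong (load C y a +_) (*-zeroʳ e)) (+-identityʳ (load C y a))))
    sum≡ : ∀ e → sumFin (λ i → y i + e * ν i) ≡ τ
    sum≡ e = begin-equality
      sumFin (λ i → y i + e * ν i)     ≡⟨ sum-distrib-+ y (λ i → e * ν i) ⟩
      sumFin y + sumFin (λ i → e * ν i) ≡⟨ cong (sumFin y +_) (*-distribˡ-sum e ν) ⟨
      sumFin y + e * sumFin ν          ≡⟨ cong (λ t → sumFin y + e * t) sum-ν≡0 ⟩
      sumFin y + e * 0ℚ                ≡⟨ cong (sumFin y +_) (*-zeroʳ e) ⟩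
      sumFin y + 0ℚ                    ≡⟨ +-identityʳ (sumFin y) ⟩
      sumFin y                         ≡⟨ maxPacking-sum y-max ⟩
      τ                                ∎

  module Empty (∣D₀∣≡0 : ∣ D₀ ∣ ≡ 0) where

    ∉D₀ : ∀ a → a ∉ D₀
    ∉D₀ a a∈D₀ = ℕ.n≮0 (ℕ.<-≤-trans (Subset.x∈p⇒∣p-x∣<∣p∣ a∈D₀) (ℕ.≤-reflexive ∣D₀∣≡0))

    no-hyperedge : Fin m → ⊥
    no-hyperedge i = let a , a∈D₀ , _ = proj₁ (proj₁ D₀-min) i in ∉D₀ a a∈D₀

    I-empty : ∀ x → ¬ I C x
    I-empty x (dot≡1 , _) = 1≢0 (trans (sym (dot≡1 D₀ D₀-min)) (dot-vanishing D₀ λ {a} a∈D₀ → ⊥-elim (∉D₀ a a∈D₀)))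

    empty-simplex : IsSimplex (I C)
    empty-simplex = 0 , (λ ()) , (λ _ _ _ ()) ,
      λ x → mk⇔ (λ x∈I → ⊥-elim (I-empty x x∈I)) (λ (_ , _ , 0≡1 , _) → ⊥-elim (1≢0 (sym 0≡1)))

  module Positive (τ′ : ℕ) (∣D₀∣≡1+τ′ : ∣ D₀ ∣ ≡ suc τ′) where

    0<τ : 0ℚ < τ
    0<τ = subst (0ℚ <_) (trans (cong ℕtoℚ (sym ∣D₀∣≡1+τ′)) (sym τ≡ℕtoℚ∣D₀∣)) (0<ℕtoℚ τ′)

    1≤τ : 1ℚ ≤ τ
    1≤τ = subst (1ℚ ≤_) (trans (cong ℕtoℚ (sym ∣D₀∣≡1+τ′)) (sym τ≡ℕtoℚ∣D₀∣)) (1≤ℕtoℚ τ′)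

    instance
      τ-pos : Positive τ
      τ-pos = positive 0<τ
      τ≢0 : NonZero τ
      τ≢0 = pos⇒nonZero τ

    opaque
      c : ℚ
      c = 1/ τ

      c*τ≡1 : c * τ ≡ 1ℚ
      c*τ≡1 = *-inverseˡ τ

      0<c : 0ℚ < c
      0<c = positive⁻¹ c {{1/pos⇒pos τ}}

    uniform∈I : I C (λ _ → c)
    uniform∈I = dot≡1 , 1≤dot , λ _ → <⇒≤ 0<c
      where
      dot≡1 : ∀ D → IsMinTransversal C D → dot (λ _ → c) D ≡ 1ℚ
      dot≡1 D D-min = begin-equality
        dot (λ _ → c) D    ≡⟨ dot-const c D ⟩
        c * ℕtoℚ ∣ D ∣     ≡⟨ cong (λ t → c * ℕtoℚ t) (minTransversal-size D-min) ⟩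
        c * ℕtoℚ ∣ D₀ ∣    ≡⟨ cong (c *_) τ≡ℕtoℚ∣D₀∣ ⟨
        c * τ              ≡⟨ c*τ≡1 ⟩
        1ℚ                 ∎
      1≤dot : ∀ D → IsTransversal C D → 1ℚ ≤ dot (λ _ → c) D
      1≤dot D D-transversal = begin
        1ℚ             ≡⟨ c*τ≡1 ⟨
        c * τ          ≤⟨ *-monoˡ-≤-nonNeg c {{nonNegative (<⇒≤ 0<c)}}
                            (≤-trans (≤-reflexive τ≡ℕtoℚ∣D₀∣) (ℕtoℚ-mono-≤ (transversal-size D-transversal))) ⟩
        c * ℕtoℚ ∣ D ∣ ≡⟨ dot-const c D ⟨
        dot (λ _ → c) D ∎

    ε : ℚ
    ε = c * c

    0<ε : 0ℚ < ε
    0<ε = 0<* 0<c 0<c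

    ω : ℚ
    ω = (1ℚ + ε) * c - ε

    0≤ω : 0ℚ ≤ ω
    0≤ω = begin
      0ℚ                       ≤⟨ +-mono-≤ (0≤* 0≤c (≤⇒0≤- c≤1)) (0≤* (<⇒≤ 0<ε) 0≤c) ⟩
      c * (1ℚ - c) + ε * c     ≡⟨ ω-identity c ⟩
      ω                        ∎
      where
      ω-identity : ∀ x → x * (1ℚ - x) + x * x * x ≡ (1ℚ + x * x) * x - x * x
      ω-identity = solve-∀ ℚ-ring
      0≤c = <⇒≤ 0<c
      c≤1 : c ≤ 1ℚ
      c≤1 = begin
        c        ≡⟨ *-identityʳ c ⟨
        c * 1ℚ   ≤⟨ *-monoˡ-≤-nonNeg c {{nonNegative 0≤c}} 1≤τ ⟩
        c * τ    ≡⟨ c*τ≡1 ⟩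
        1ℚ       ∎

    1≤ω[1+τ] : 1ℚ ≤ ω * (1ℚ + τ)
    1≤ω[1+τ] = begin
      1ℚ                                           ≡⟨ +-identityʳ 1ℚ ⟨
      1ℚ + 0ℚ                                      ≤⟨ +-monoʳ-≤ 1ℚ (0≤* (<⇒≤ 0<ε) (<⇒≤ 0<c)) ⟩
      1ℚ + ε * c                                   ≡⟨ +-identityʳ (1ℚ + ε * c) ⟨
      1ℚ + ε * c + 0ℚ                              ≡⟨ cong (1ℚ + ε * c +_) (trans (cong (_* (1ℚ + ε - c)) c*τ-1≡0) (*-zeroˡ (1ℚ + ε - c))) ⟨
      1ℚ + ε * c + (c * τ - 1ℚ) * (1ℚ + ε - c)     ≡⟨ ω[1+τ]-identity c τ ⟩
      ω * (1ℚ + τ)                                 ∎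
      where
      ω[1+τ]-identity : ∀ x t → 1ℚ + x * x * x + (x * t - 1ℚ) * (1ℚ + x * x - x) ≡ ((1ℚ + x * x) * x - x * x) * (1ℚ + t)
      ω[1+τ]-identity = solve-∀ ℚ-ring
      c*τ-1≡0 : c * τ - 1ℚ ≡ 0ℚ
      c*τ-1≡0 = trans (cong (_- 1ℚ) c*τ≡1) (+-inverseʳ 1ℚ)

    -- Minimum transversals keep weight 1, and ε = c² is small enough that every larger
    -- transversal still has weight at least ω (1 + τ) ≥ 1.
    perturbed∈I : ∀ {x} → I C x → (∀ a → x a ≤ 1ℚ) → I C (λ a → (1ℚ + ε) * c - ε * x a)
    perturbed∈I {x} (dot≡1 , _ , _) x≤1 = dotz≡1 , 1≤dotz , λ a → ≤-trans 0≤ω (ω≤z a)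
      where
      z : Fin n → ℚ
      z a = (1ℚ + ε) * c - ε * x a
      ω≤z : ∀ a → ω ≤ z a
      ω≤z a = +-monoʳ-≤ ((1ℚ + ε) * c) (neg-antimono-≤ (begin
        ε * x a   ≤⟨ *-monoˡ-≤-nonNeg ε {{nonNegative (<⇒≤ 0<ε)}} (x≤1 a) ⟩
        ε * 1ℚ    ≡⟨ *-identityʳ ε ⟩
        ε         ∎))
      dotz≡1 : ∀ D → IsMinTransversal C D → dot z D ≡ 1ℚ
      dotz≡1 D D-min = begin-equality
        dot z D
          ≡⟨ dot-- (λ _ → (1ℚ + ε) * c) (λ a → ε * x a) D ⟩
        dot (λ _ → (1ℚ + ε) * c) D - dot (λ a → ε * x a) D
          ≡⟨ cong₂ _-_ (*-dot (1ℚ + ε) (λ _ → c) D) (*-dot ε x D) ⟨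
        (1ℚ + ε) * dot (λ _ → c) D - ε * dot x D
          ≡⟨ cong₂ (λ u v → (1ℚ + ε) * u - ε * v) (proj₁ uniform∈I D D-min) (dot≡1 D D-min) ⟩
        (1ℚ + ε) * 1ℚ - ε * 1ℚ
          ≡⟨ [1+e]-e≡1 ε ⟩
        1ℚ ∎
        where
        [1+e]-e≡1 : ∀ e → (1ℚ + e) * 1ℚ - e * 1ℚ ≡ 1ℚ
        [1+e]-e≡1 = solve-∀ ℚ-ring
      1≤dotz : ∀ D → IsTransversal C D → 1ℚ ≤ dot z D
      1≤dotz D D-transversal with ∣ D ∣ ℕ.≤? ∣ D₀ ∣
      ... | yes ∣D∣≤∣D₀∣ = ≤-reflexive (sym (dotz≡1 D (minTransversal-intro D-transversal ∣D∣≤∣D₀∣)))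
      ... | no  ∣D∣≰∣D₀∣ = begin
        1ℚ                     ≤⟨ 1≤ω[1+τ] ⟩
        ω * (1ℚ + τ)           ≡⟨ cong (λ t → ω * (1ℚ + t)) τ≡ℕtoℚ∣D₀∣ ⟩
        ω * (1ℚ + ℕtoℚ ∣ D₀ ∣) ≡⟨ cong (ω *_) (ℕtoℚ-suc ∣ D₀ ∣) ⟨
        ω * ℕtoℚ (suc ∣ D₀ ∣)  ≤⟨ *-monoˡ-≤-nonNeg ω {{nonNegative 0≤ω}} (ℕtoℚ-mono-≤ (ℕ.≰⇒> ∣D∣≰∣D₀∣)) ⟩
        ω * ℕtoℚ ∣ D ∣         ≡⟨ dot-const ω D ⟨
        dot (λ _ → ω) D        ≤⟨ dot-mono-≤ D ω≤z ⟩
        dot z D                ∎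

    module Hull {k : ℕ} (q : Fin k → Fin n → ℚ) (hull : ∀ x → I C x ⇔ InConv q x) where

      q∈I : ∀ j → I C (q j)
      q∈I j = Equivalence.from (hull (q j)) (InConv-vertex q j)

      0≤q : ∀ j a → 0ℚ ≤ q j a
      0≤q j = proj₂ (proj₂ (q∈I j))

      -- Otherwise the uniform point plus any multiple of the unit vector at a would lie in
      -- I(C), which is bounded.
      element-in-minTransversal : ∀ a → ¬ ¬ (∃[ D ] (IsMinTransversal C D × a ∈ D))
      element-in-minTransversal a ¬D = <-irrefl refl (<-≤-trans M<za za≤M)
        where
        M : ℚ
        M = sumFin (λ j → q j a)
        z : Fin n → ℚ
        z b = c + (M + 1ℚ) * δ a b
        c≤z : ∀ b → c ≤ z b
        c≤z b = ≤-trans (≤-reflexive (sym (+-identityʳ c)))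
                  (+-monoʳ-≤ c (0≤* (+-mono-≤ (0≤sum (λ j → 0≤q j a)) 0≤1) (0≤δ a b)))
        dot≡1 : ∀ D → IsMinTransversal C D → dot z D ≡ 1ℚ
        dot≡1 D D-min = begin-equality
          dot z D                                    ≡⟨ dot-+ (λ _ → c) (λ b → (M + 1ℚ) * δ a b) D ⟩
          dot (λ _ → c) D + dot (λ b → (M + 1ℚ) * δ a b) D
            ≡⟨ cong₂ _+_ (proj₁ uniform∈I D D-min) (dot-vanishing D bump≡0) ⟩
          1ℚ + 0ℚ                                    ≡⟨ +-identityʳ 1ℚ ⟩
          1ℚ                                         ∎
          where
          bump≡0 : ∀ {b} → b ∈ D → (M + 1ℚ) * δ a b ≡ 0ℚ
          bump≡0 b∈D = trans (cong ((M + 1ℚ) *_) (ifEq-≢ {i = a} 1ℚ (λ { refl → ¬D (D , D-min , b∈D) }))) (*-zeroʳ (M + 1ℚ))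
        z∈I : I C z
        z∈I = dot≡1
            , (λ D D-transversal → ≤-trans (proj₁ (proj₂ uniform∈I) D D-transversal) (dot-mono-≤ D c≤z))
            , (λ b → ≤-trans (<⇒≤ 0<c) (c≤z b))
        za≤M : z a ≤ M
        za≤M = InConv⇒≤sum q 0≤q (Equivalence.to (hull z) z∈I) a
        M<za : M < z a
        M<za = begin-strict
          M                    ≡⟨ +-identityˡ M ⟨
          0ℚ + M               <⟨ +-mono-<-≤ 0<c (≤-trans (≤-reflexive (sym (+-identityʳ M))) (+-monoʳ-≤ M 0≤1)) ⟩
          c + (M + 1ℚ)         ≡⟨ cong (c +_) (trans (sym (*-identityʳ (M + 1ℚ))) (cong ((M + 1ℚ) *_) (sym (ifEq-refl a 1ℚ)))) ⟩
          z a                  ∎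

      I⇒≤1 : ∀ {x} → I C x → ∀ a → x a ≤ 1ℚ
      I⇒≤1 {x} (dot≡1 , _ , 0≤x) a = decidable-stable (x a ≤? 1ℚ) λ xa≰1 →
        element-in-minTransversal a λ (D , D-min , a∈D) →
          xa≰1 (≤-trans (coordinate≤dot D 0≤x a∈D) (≤-reflexive (dot≡1 D D-min)))

      maxPacking-load≡1 : ∀ {y} → IsMaxPacking C y → ∀ a → load C y a ≡ 1ℚ
      maxPacking-load≡1 {y} y-max a = decidable-stable (load C y a ≟ 1ℚ) λ load≢1 →
        element-in-minTransversal a λ (D , D-min , a∈D) →
          load≢1 (proj₁ (maxPacking-tight y-max D-min) a∈D)

      ≤∧dot≡⇒≡ : ∀ {u v : Fin n → ℚ} → (∀ a → u a ≤ v a) →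
                 (∀ D → IsMinTransversal C D → dot u D ≡ dot v D) → ∀ a → u a ≡ v a
      ≤∧dot≡⇒≡ {u} {v} u≤v dot≡ a = decidable-stable (u a ≟ v a) λ ua≢va →
        element-in-minTransversal a λ (D , D-min , a∈D) → ua≢va (begin-equality
          u a                       ≡⟨ ind-∈ {D = D} (u a) a∈D ⟨
          ind (lookup D a) (u a)    ≡⟨ sum-≤-≡⇒≡ (λ b → ind-mono-≤ (lookup D b) (u≤v b)) (dot≡ D D-min) a ⟩
          ind (lookup D a) (v a)    ≡⟨ ind-∈ {D = D} (v a) a∈D ⟩
          v a                       ∎)

      indicator∈I⇒vertex : ∀ H → I C (𝟙 H) → ∃[ l ] (∀ a → q l a ≡ 𝟙 H a)
      indicator∈I⇒vertex H 𝟙H∈I with Equivalence.to (hull (𝟙 H)) 𝟙H∈I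
      ... | κ , 0≤κ , sum-κ≡1 , 𝟙H≗ with Fin.any? (λ l → 0ℚ <? κ l)
      ...   | no  ∄l = ⊥-elim (1≢0 (trans (sym sum-κ≡1) (trans (sum-cong κ≡0) (sum-zero k))))
        where
        κ≡0 : ∀ l → κ l ≡ 0ℚ
        κ≡0 l = ≤-antisym (≮⇒≥ (λ 0<κl → ∄l (l , 0<κl))) (0≤κ l)
      ...   | yes (l , 0<κl) = l , ≤∧dot≡⇒≡ ql≤𝟙H dot≡
        where
        ql≡0 : ∀ {b} → b ∉ H → q l b ≡ 0ℚ
        ql≡0 {b} b∉H = 0<∧*≡0⇒≡0 0<κl (sum≡0⇒≡0 (λ s → 0≤* (0≤κ s) (0≤q s b))
                         (trans (sym (𝟙H≗ b)) (ind-∉ {D = H} 1ℚ b∉H)) l)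
        ql≤𝟙H : ∀ b → q l b ≤ 𝟙 H b
        ql≤𝟙H b with b Subset.∈? H
        ... | yes b∈H = ≤-trans (I⇒≤1 (q∈I l) b) (≤-reflexive (sym (ind-∈ {D = H} 1ℚ b∈H)))
        ... | no  b∉H = ≤-reflexive (trans (ql≡0 b∉H) (sym (ind-∉ {D = H} 1ℚ b∉H)))
        dot≡ : ∀ D → IsMinTransversal C D → dot (q l) D ≡ dot (𝟙 H) D
        dot≡ D D-min = trans (proj₁ (q∈I l) D D-min) (sym (proj₁ 𝟙H∈I D D-min))

      module _ (clutter : IsClutter C) (independent : AffinelyIndependent q) where

        private
          support-edge-vertex : ∀ {y} → IsMaxPacking C y → ∀ i → 0ℚ < y i → ∃[ l ] (∀ a → q l a ≡ 𝟙 (C i) a)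
          support-edge-vertex y-max i 0<yi = indicator∈I⇒vertex (C i) (support-edge∈I y-max i 0<yi)

        -- The difference of two maximum packings, transported to the vertices, is an affine dependence.
        uniqueMaxPacking : UniqueMaxPacking C
        uniqueMaxPacking y y′ y-max y′-max i = x-y≡0⇒x≡y (w≡0 i)
          where
          w : Fin m → ℚ
          w i = y i - y′ i
          vertexOf : ∀ i → ∃[ l ] (w i ≢ 0ℚ → ∀ a → q l a ≡ 𝟙 (C i) a)
          vertexOf i with w i ≟ 0ℚ
          ... | yes wi≡0 = InConv⇒index (Equivalence.to (hull (λ _ → c)) uniform∈I) , λ wi≢0 → ⊥-elim (wi≢0 wi≡0)
          ... | no  wi≢0 with 0ℚ <? y i
          ...   | yes 0<yi = let l , ql≗ = support-edge-vertex y-max i 0<yi in l , λ _ → ql≗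
          ...   | no  0≮yi = let l , ql≗ = support-edge-vertex y′-max i 0<y′i in l , λ _ → ql≗
            where
            0<y′i : 0ℚ < y′ i
            0<y′i = 0≤∧≢0⇒0< (proj₁ (proj₁ y′-max) i) λ y′i≡0 → wi≢0 (begin-equality
              y i - y′ i   ≡⟨ cong₂ _-_ (≤-antisym (≮⇒≥ 0≮yi) (proj₁ (proj₁ y-max) i)) y′i≡0 ⟩
              0ℚ - 0ℚ      ≡⟨ +-inverseʳ 0ℚ ⟩
              0ℚ           ∎)
          f : Fin m → Fin k
          f i = proj₁ (vertexOf i)
          μ : Fin k → ℚ
          μ = pushforward f w
          sum-μ≡0 : sumFin μ ≡ 0ℚ
          sum-μ≡0 = begin-equality
            sumFin μ                   ≡⟨ sum-pushforward f w ⟩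
            sumFin w                   ≡⟨ sum-distrib-- y y′ ⟩
            sumFin y - sumFin y′       ≡⟨ cong₂ _-_ (maxPacking-sum y-max) (maxPacking-sum y′-max) ⟩
            τ - τ                      ≡⟨ +-inverseʳ τ ⟩
            0ℚ                         ∎
          Σμq≡0 : ∀ a → sumFin (λ l → μ l * q l a) ≡ 0ℚ
          Σμq≡0 a = begin-equality
            sumFin (λ l → μ l * q l a)                 ≡⟨ sum-pushforward-* f w (λ l → q l a) ⟩
            sumFin (λ i → w i * q (f i) a)             ≡⟨ sum-cong (λ i → *-congˡ-≢0 (w i) (λ wi≢0 → proj₂ (vertexOf i) wi≢0 a)) ⟩
            sumFin (λ i → w i * 𝟙 (C i) a)             ≡⟨ load-difference C y y′ a ⟨
            load C y a - load C y′ a                   ≡⟨ cong₂ _-_ (maxPacking-load≡1 y-max a) (maxPacking-load≡1 y′-max a) ⟩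
            1ℚ - 1ℚ                                    ≡⟨ +-inverseʳ 1ℚ ⟩
            0ℚ                                         ∎
          shared-vertex⇒w≡0 : ∀ i → w i ≢ 0ℚ → ∀ i′ → i′ ≢ i → f i′ ≡ f i → w i′ ≡ 0ℚ
          shared-vertex⇒w≡0 i wi≢0 i′ i′≢i fi′≡fi = decidable-stable (w i′ ≟ 0ℚ) λ wi′≢0 →
            i′≢i (clutter⇒𝟙-injective C clutter i′ i λ a →
              trans (sym (proj₂ (vertexOf i′) wi′≢0 a)) (trans (cong (λ l → q l a) fi′≡fi) (proj₂ (vertexOf i) wi≢0 a)))
          w≡0 : ∀ i → w i ≡ 0ℚ
          w≡0 i = decidable-stable (w i ≟ 0ℚ) λ wi≢0 → wi≢0 (begin-equality
            w i         ≡⟨ pushforward-fibre f w i (shared-vertex⇒w≡0 i wi≢0) ⟨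
            μ (f i)     ≡⟨ independent μ sum-μ≡0 Σμq≡0 (f i) ⟩
            0ℚ          ∎)

    module Integral {k : ℕ} (pℤ : Fin k → Fin n → ℤ) (hull : ∀ x → I C x ⇔ InConv (λ j a → pℤ j a / 1) x) where

      p : Fin k → Fin n → ℚ
      p j a = pℤ j a / 1

      open Hull p hull public

      -- p j is 0/1-valued; if no hyperedge lay inside its support, the zeros of p j would
      -- contain a transversal of weight 0.
      vertex-is-edge : ∀ j → ∃[ h ] (∀ a → p j a ≡ 𝟙 (C h) a)
      vertex-is-edge j = decidable-stable (Fin.any? λ h → Fin.all? λ a → p j a ≟ 𝟙 (C h) a) λ ¬edge →
        some-edge⊆ones λ (h , Ch⊆ones) → ¬edge (h , λ a → sym (edge≗vertex h Ch⊆ones a))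
        where
        ones : Subset n
        ones = level-set (p j) 1ℚ
        p≡0∨1 : ∀ a → p j a ≡ 0ℚ ⊎ p j a ≡ 1ℚ
        p≡0∨1 a = integer∈[0,1] (pℤ j a) (0≤q j a) (I⇒≤1 (q∈I j) a)
        p≡0-off-ones : ∀ {a} → a ∉ ones → p j a ≡ 0ℚ
        p≡0-off-ones {a} a∉ones =
          Data.Sum.[ (λ pa≡0 → pa≡0) , (λ pa≡1 → ⊥-elim (a∉ones (∈-level-set⁺ {x = p j} {1ℚ} pa≡1))) ]′ (p≡0∨1 a)
        some-edge⊆ones : ¬ ¬ (∃[ h ] (C h ⊆ ones))
        some-edge⊆ones ∄h = cover⇒¬¬transversal⊆ C (∁ ones) ∁ones-covers λ (T , T⊆∁ones , T-transversal) →
          <-irrefl refl (<-≤-trans 0<1 (≤-trans (proj₁ (proj₂ (q∈I j)) T T-transversal)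
            (≤-reflexive (dot-vanishing T (λ a∈T → p≡0-off-ones (Subset.x∈∁p⇒x∉p (T⊆∁ones a∈T)))))))
          where
          ∁ones-covers : IsCover C (∁ ones)
          ∁ones-covers i = let a , a∈Ci , a∉ones = ⊈⇒∃∈∉ (λ Ci⊆ones → ∄h (i , Ci⊆ones)) in
            a , Subset.x∉p⇒x∈∁p a∉ones , a∈Ci
        edge≗vertex : ∀ h → C h ⊆ ones → ∀ a → 𝟙 (C h) a ≡ p j a
        edge≗vertex h Ch⊆ones = ≤∧dot≡⇒≡ 𝟙≤p dot≡
          where
          𝟙≤p : ∀ a → 𝟙 (C h) a ≤ p j a
          𝟙≤p a with a Subset.∈? C h
          ... | yes a∈Ch = ≤-reflexive (trans (ind-∈ {D = C h} 1ℚ a∈Ch) (sym (∈-level-set⁻ {x = p j} {1ℚ} (Ch⊆ones a∈Ch))))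
          ... | no  a∉Ch = ≤-trans (≤-reflexive (ind-∉ {D = C h} 1ℚ a∉Ch)) (0≤q j a)
          dot≡ : ∀ D → IsMinTransversal C D → dot (𝟙 (C h)) D ≡ dot (p j) D
          dot≡ D D-min = ≤-antisym (dot-mono-≤ D 𝟙≤p)
            (≤-trans (≤-reflexive (proj₁ (q∈I j) D D-min)) (meets⇒1≤dot𝟙 (proj₁ (proj₁ D-min) h)))

      module _ (unique : UniqueMaxPacking C) where

        edge : Fin k → Fin m
        edge s = proj₁ (vertex-is-edge s)

        p≗𝟙edge : ∀ s a → p s a ≡ 𝟙 (C (edge s)) a
        p≗𝟙edge s = proj₂ (vertex-is-edge s)

        edge-packing : (uniform∈conv : InConv p (λ _ → c)) →
                       IsMaxPacking C (λ i → τ * pushforward edge (proj₁ uniform∈conv) i)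
        edge-packing (β , 0≤β , sum-β≡1 , c≗) = maxPacking-intro (0≤y , λ a → ≤-reflexive (load≡1 a)) sum≡τ
          where
          y : Fin m → ℚ
          y i = τ * pushforward edge β i
          0≤y : ∀ i → 0ℚ ≤ y i
          0≤y i = 0≤* (<⇒≤ 0<τ) (0≤pushforward edge 0≤β i)
          load≡1 : ∀ a → load C y a ≡ 1ℚ
          load≡1 a = begin-equality
            load C y a                                          ≡⟨ load-as-sum C y a ⟩
            sumFin (λ i → τ * pushforward edge β i * 𝟙 (C i) a)  ≡⟨ sum-cong (λ i → *-assoc τ (pushforward edge β i) (𝟙 (C i) a)) ⟩
            sumFin (λ i → τ * (pushforward edge β i * 𝟙 (C i) a)) ≡⟨ *-distribˡ-sum τ (λ i → pushforward edge β i * 𝟙 (C i) a) ⟨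
            τ * sumFin (λ i → pushforward edge β i * 𝟙 (C i) a) ≡⟨ cong (τ *_) (sum-pushforward-* edge β (λ i → 𝟙 (C i) a)) ⟩
            τ * sumFin (λ s → β s * 𝟙 (C (edge s)) a)          ≡⟨ cong (τ *_) (sum-cong (λ s → cong (β s *_) (p≗𝟙edge s a))) ⟨
            τ * sumFin (λ s → β s * p s a)                     ≡⟨ cong (τ *_) (c≗ a) ⟨
            τ * c                                              ≡⟨ *-comm τ c ⟩
            c * τ                                              ≡⟨ c*τ≡1 ⟩
            1ℚ                                                 ∎
          sum≡τ : sumFin y ≡ τ
          sum≡τ = begin-equality
            sumFin y                        ≡⟨ *-distribˡ-sum τ (pushforward edge β) ⟨
            τ * sumFin (pushforward edge β) ≡⟨ cong (τ *_) (trans (sum-pushforward edge β) sum-β≡1) ⟩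
            τ * 1ℚ                          ≡⟨ *-identityʳ τ ⟩
            τ                               ∎

        -- Writing the uniform point as a convex combination with positive weight on p l
        -- gives a maximum packing that uses edge l; by uniqueness it is y₀.
        vertex-in-support : ∀ l → 0ℚ < y₀ (edge l)
        vertex-in-support l = begin-strict
          0ℚ                     <⟨ 0<* 0<τ 0<βl ⟩
          τ * β l                ≤⟨ *-monoˡ-≤-nonNeg τ {{nonNegative (<⇒≤ 0<τ)}} (≤-pushforward edge (proj₁ (proj₂ uniform∈conv)) l) ⟩
          τ * pushforward edge β (edge l) ≡⟨ unique y₀ (λ i → τ * pushforward edge β i) y₀-max (edge-packing uniform∈conv) (edge l) ⟨
          y₀ (edge l)            ∎
          where
          z∈I = perturbed∈I (q∈I l) (I⇒≤1 (q∈I l))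
          shifted = InConv-shift p l 0<ε (Equivalence.to (hull (λ a → (1ℚ + ε) * c - ε * p l a)) z∈I) (λ a → x≡[x-y]+y ((1ℚ + ε) * c) (ε * p l a))
            where
            x≡[x-y]+y : ∀ x y → x ≡ (x - y) + y
            x≡[x-y]+y = solve-∀ ℚ-ring
          uniform∈conv = proj₁ shifted
          β = proj₁ uniform∈conv
          0<βl = proj₂ shifted

        private
          support : Enumeration (λ i → 0ℚ < y₀ i)
          support = enumerate (λ i → 0ℚ <? y₀ i)

        open Enumeration support

        support-edges : Fin size → Fin n → ℚ
        support-edges j = 𝟙 (C (index j))

        I⇒InConv-support-edges : ∀ {x} → I C x → InConv support-edges x
        I⇒InConv-support-edges {x} x∈I with Equivalence.to (hull x) x∈I
        ... | w , 0≤w , sum-w≡1 , x≗ = κ , 0≤pushforward position 0≤w , trans (sum-pushforward position w) sum-w≡1 , x≗κ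
          where
          position : Fin k → Fin size
          position s = proj₁ (complete (edge s) (vertex-in-support s))
          κ : Fin size → ℚ
          κ = pushforward position w
          x≗κ : ∀ b → x b ≡ sumFin (λ j → κ j * support-edges j b)
          x≗κ b = begin-equality
            x b                                             ≡⟨ x≗ b ⟩
            sumFin (λ s → w s * p s b)                      ≡⟨ sum-cong (λ s → cong (w s *_) (trans (p≗𝟙edge s b)
                                                                 (cong (λ i → 𝟙 (C i) b) (sym (proj₂ (complete (edge s) (vertex-in-support s))))))) ⟩
            sumFin (λ s → w s * support-edges (position s) b) ≡⟨ sum-pushforward-* position w (λ j → support-edges j b) ⟨
            sumFin (λ j → κ j * support-edges j b)          ∎

        -- An affine dependence among the support edges would move y₀ to another maximum packing.
        support-edges-independent : AffinelyIndependent support-edges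
        support-edges-independent μ sum-μ≡0 Σμ𝟙≡0 j = begin-equality
          μ j             ≡⟨ pushforward-fibre index μ j (λ j′ j′≢j index≡ → ⊥-elim (j′≢j (injective index≡))) ⟨
          ν (index j)     ≡⟨ ν≡0 (index j) ⟩
          0ℚ              ∎
          where
          ν : Fin m → ℚ
          ν = pushforward index μ
          ν≡0-off-support : ∀ i → ¬ 0ℚ < y₀ i → ν i ≡ 0ℚ
          ν≡0-off-support i 0≮y₀i = pushforward-∉image index μ i (λ j index≡i → 0≮y₀i (subst (λ i → 0ℚ < y₀ i) index≡i (sound j)))
          load-ν≡0 : ∀ a → load C ν a ≡ 0ℚ
          load-ν≡0 a = trans (load-as-sum C ν a) (trans (sum-pushforward-* index μ (λ i → 𝟙 (C i) a)) (Σμ𝟙≡0 a))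
          ν≡0 : ∀ i → ν i ≡ 0ℚ
          ν≡0 i = let e , 0<e , perturbed-max = perturbed-maxPacking y₀-max ν (trans (sum-pushforward index μ) sum-μ≡0) load-ν≡0 ν≡0-off-support in
            0<∧*≡0⇒≡0 0<e (+-identityʳ-unique (y₀ i) (e * ν i) (sym (unique y₀ _ y₀-max perturbed-max i)))

        support-simplex : IsSimplex (I C)
        support-simplex = size , support-edges , support-edges-independent ,
          λ x → mk⇔ I⇒InConv-support-edges (I-convex support-edges (λ j → support-edge∈I y₀-max (index j) (sound j)))

lemma5p2 : (n m : ℕ) (C : Fin m → Subset n) → IsClutter C → IntegralBlocking C
    → IsIntegralPolytope (I C) → (UniqueMaxPacking C ⇔ IsSimplex (I C))
lemma5p2 n m C clutter blocking (k , pℤ , integral-hull) with ∣ Blocking.D₀ C blocking ∣ in ∣D₀∣≡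
... | zero   = mk⇔ (λ _ → empty-simplex) (λ _ _ _ _ _ i → ⊥-elim (no-hyperedge i))
  where open Blocking.Empty C blocking ∣D₀∣≡
... | suc τ′ = mk⇔ (support-simplex pℤ integral-hull)
                   (λ (_ , q , independent , hull) → uniqueMaxPacking q hull clutter independent)
  where open Blocking.Positive C blocking τ′ ∣D₀∣≡
        open Integral using (support-simplex)
        open Hull using (uniqueMaxPacking)
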